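{- Let $n\ge3$, $1\le k<n$, let $z=(0,00\cdots0)$ and $v=(j,y)$ be vertices of $\mathrm{PX}(n,k)$, and let $M=\{0,1,\dots,k-1\}\cap\{j,j+1,\dots,j+k-1\}\subseteq\mathbb Z_n$. Then there exists $\alpha\in\mathcal A$ with $\alpha\cdot z=v$ and $\alpha\cdot v=z$ if and only if one of the following holds: (1) $j=0$; (2) $j\ne0$ and for all $m\in M$, $y_{m-j}=(y^-)_m=y_{k-1-m}$; (3) $n$ is even, $j=n/2$, and for all $m\in M$, $y_{m-j}=y_m$.
   Context: For integers $n\ge 3$ and $1\le k<n$, $\mathrm{PX}(n,k)$ has vertex set $\mathbb Z_n\times\mathbb Z_2^k$, vertices written $(i,x)$ with $x=x_0x_1\cdots x_{k-1}$ (bit indices read in $\mathbb Z_k$); $(i,x)$ and $(j,y)$ are adjacent iff (up to swapping) $j=i+1$ in $\mathbb Z_n$, $x=az_1\cdots z_{k-1}$ and $y=z_1\cdots z_{k-1}b$ for some bits $a,b,z_t$. For a bitstring $y$, $y^-=y_{k-1}\cdots y_0$, and $x^t$ is $x$ with bit $x_t$ flipped. Automorphisms: $\rho\cdot(i,x)=(i+1,x)$; $\mu\cdot(i,x)=(-i,x^-)$; for $s\in\mathbb Z_n$, $\tau_s\cdot(i,x)=(i,x^{s-i})$ if $i\in\{s,s-1,\dots,s-k+1\}$ and $(i,x)$ otherwise. Let $\mathcal A$ be the subgroup of $\operatorname{Aut}(\mathrm{PX}(n,k))$ generated by $\rho,\mu,\tau_0,\dots,\tau_{n-1}$. -}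

module Defs where

open import Data.Nat using (ℕ; zero; suc; _+_; _*_; _∸_; _<_; _<?_; NonZero)
open import Data.Nat.DivMod using (_mod_)
open import Data.Fin using (Fin; toℕ; fromℕ<)
open import Data.Bool using (Bool; not)
open import Data.Vec using (Vec; reverse; updateAt; lookup)
open import Data.Product using (_×_; _,_; ∃)
open import Data.List using (List; []; _∷_)
open import Relation.Nullary using (yes; no)

module _ (n : ℕ) .{{_ : NonZero n}} where

  addZ : Fin n → Fin n → Fin n
  addZ i j = (toℕ i + toℕ j) mod n

  negZ : Fin n → Fin n
  negZ i = (n ∸ toℕ i) mod n

  subZ : Fin n → Fin n → Fin n
  subZ i j = addZ i (negZ j)

  oneZ : Fin n
  oneZ = 1 mod n

module _ (n k : ℕ) .{{_ : NonZero n}} where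

  Vertex : Set
  Vertex = Fin n × Vec Bool k

  flipBit : Vec Bool k → Fin k → Vec Bool k
  flipBit x t = updateAt x t not

  ρ : Vertex → Vertex
  ρ (i , x) = (addZ n i (oneZ n) , x)

  ρ⁻¹ : Vertex → Vertex
  ρ⁻¹ (i , x) = (subZ n i (oneZ n) , x)

  μ : Vertex → Vertex
  μ (i , x) = (negZ n i , reverse x)

  -- τ_s (i,x) = (i, x^{s-i}) if i ∈ {s, s-1, …, s-k+1}, i.e. (s - i mod n) < k;
  -- otherwise (i , x)
  τ : Fin n → Vertex → Vertex
  τ s (i , x) with toℕ (subZ n s i) <? k
  ... | yes p = (i , flipBit x (fromℕ< p))
  ... | no _  = (i , x)

  -- generators of 𝒜 together with formal inverses
  -- (μ and τ_s are involutions, so they are their own inverses)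
  data Gen : Set where
    gρ gρ⁻¹ gμ : Gen
    gτ : Fin n → Gen

  actGen : Gen → Vertex → Vertex
  actGen gρ   = ρ
  actGen gρ⁻¹ = ρ⁻¹
  actGen gμ   = μ
  actGen (gτ s) = τ s

  actWord : List Gen → Vertex → Vertex
  actWord [] v = v
  actWord (g ∷ w) v = actGen g (actWord w v)

  InA : (Vertex → Vertex) → Set
  InA α = ∃ λ (w : List Gen) → (v : Vertex) → actWord w v ≡ α v
    where open import Relation.Binary.PropositionalEquality using (_≡_)

-- Every element of 𝒜 acts in one of the normal forms
--   (i , x) ↦ (i + a , x + c|ᵢ)   or   (i , x) ↦ (a − i , reverse (x + c|ᵢ)),
-- where c : ℤₙ → Bool is a pattern and c|ᵢ its restriction to the window i , … , i + k − 1: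
-- every generator maps normal forms to normal forms (τ_s toggles c at one point), and
-- conversely the τ_s produce every pattern, μ the reflection and powers of ρ every shift.
-- Such a map exchanges (0 , 0⋯0) and (j , y) exactly when a = j, c reads y on the window
-- of j, and c reads y (preserving form, which also forces j + j = 0) or y reversed
-- (reflecting form) on the window of 0. A pattern with prescribed values on two windows
-- exists iff the prescriptions agree on their overlap M; for j = 0 the preserving form
-- with c = y on the window of 0 always works.

module Submission where

open import Defs
open import Algebra.Bundles using (AbelianGroup)
import Algebra.Properties.AbelianGroup as AbelianGroupProperties
import Algebra.Properties.CommutativeSemigroup as CommutativeSemigroupProperties
open import Data.Bool using (Bool; true; false; not; _xor_; _∧_)
open import Data.Bool.Properties using (xor-assoc; xor-same; xor-identityʳ; ∧-identityʳ; ∧-zeroʳ)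
open import Data.Empty using (⊥-elim)
open import Data.Fin using (Fin; toℕ; fromℕ<; fromℕ; inject₁; opposite) renaming (zero to fzero; suc to fsuc)
open import Data.Fin.Properties
  using (any?; _≟_; toℕ-injective; toℕ-fromℕ<; toℕ<n; opposite-prop; opposite-involutive)
open import Data.List using (List; []; _∷_)
import Data.Nat as ℕ
open import Data.Nat using (ℕ; zero; suc; s≤s; z≤n; _+_; _*_; _∸_; _≤_; _<_; _<?_; _%_; NonZero; >-nonZero⁻¹)
open import Data.Nat.DivMod
  using (_mod_; _/_; m%n<n; m<n⇒m%n≡m; %-distribˡ-+; m%n%n≡m%n; n%n≡0; m≡m%n+[m/n]*n; m<n*o⇒m/o<n)
open import Data.Nat.Properties
  using (+-comm; +-assoc; +-identityʳ; *-comm; +-mono-<; m+n≡0⇒m≡0; m+[n∸m]≡n; m∸n+n≡m; ∸-+-assoc;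
         ∸-monoˡ-≤; <-trans; <⇒≤; <⇒≱; ≤-refl; ≤∧≢⇒<)
open import Data.Product using (_×_; _,_; ∃; proj₁; proj₂)
open import Data.Sum using (_⊎_; inj₁; inj₂)
open import Data.Vec using (Vec; []; _∷_; _∷ʳ_; lookup; tabulate; reverse; replicate; updateAt)
open import Data.Vec.Properties
  using (reverse-∷; reverse-reverse; reverse-involutive; lookup-replicate; tabulate-cong;
         lookup∘tabulate; tabulate∘lookup; lookup∘updateAt; lookup∘updateAt′)
open import Data.Vec.Relation.Binary.Pointwise.Extensional using (ext; Pointwise-≡⇒≡)
open import Function.Bundles using (_⇔_; mk⇔; Equivalence)
open import Function.Construct.Composition using (_⇔-∘_)
open import Level using (0ℓ)
open import Relation.Binary.PropositionalEquality
open import Relation.Nullary using (Dec; yes; no; does)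
open import Relation.Nullary.Decidable using (dec-true; dec-false)

open ≡-Reasoning

module _ {a} {A : Set a} where

  lookup-ext : ∀ {m} {xs ys : Vec A m} → (∀ i → lookup xs i ≡ lookup ys i) → xs ≡ ys
  lookup-ext xs≗ys = Pointwise-≡⇒≡ (ext xs≗ys)

  lookup-∷ʳ-fromℕ : ∀ {m} (xs : Vec A m) x → lookup (xs ∷ʳ x) (fromℕ m) ≡ x
  lookup-∷ʳ-fromℕ []       x = refl
  lookup-∷ʳ-fromℕ (_ ∷ xs) x = lookup-∷ʳ-fromℕ xs x

  lookup-∷ʳ-inject₁ : ∀ {m} (xs : Vec A m) x i → lookup (xs ∷ʳ x) (inject₁ i) ≡ lookup xs i
  lookup-∷ʳ-inject₁ (_ ∷ xs) x fzero    = refl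
  lookup-∷ʳ-inject₁ (_ ∷ xs) x (fsuc i) = lookup-∷ʳ-inject₁ xs x i

  lookup-reverse-opposite : ∀ {m} (xs : Vec A m) i → lookup (reverse xs) (opposite i) ≡ lookup xs i
  lookup-reverse-opposite (x ∷ xs) fzero    rewrite reverse-∷ x xs = lookup-∷ʳ-fromℕ (reverse xs) x
  lookup-reverse-opposite (x ∷ xs) (fsuc i) rewrite reverse-∷ x xs =
    trans (lookup-∷ʳ-inject₁ (reverse xs) x (opposite i)) (lookup-reverse-opposite xs i)

  lookup-reverse : ∀ {m} (xs : Vec A m) i → lookup (reverse xs) i ≡ lookup xs (opposite i)
  lookup-reverse xs i = trans (cong (lookup (reverse xs)) (sym (opposite-involutive i)))
                              (lookup-reverse-opposite xs (opposite i))

xor≡false⇒≡ : ∀ {a b} → a xor b ≡ false → a ≡ b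
xor≡false⇒≡ {false} {false} _ = refl
xor≡false⇒≡ {true}  {true}  _ = refl

m*2≡m+m : ∀ m → m * 2 ≡ m + m
m*2≡m+m m = trans (*-comm m 2) (cong (m +_) (+-identityʳ m))

m<2n∧m%n≡0⇒m≡0⊎m≡n : ∀ {m n} .{{_ : NonZero n}} → m < 2 * n → m % n ≡ 0 → m ≡ 0 ⊎ m ≡ n
m<2n∧m%n≡0⇒m≡0⊎m≡n {m} {n} m<2n m%n≡0 with m / n | m<n*o⇒m/o<n {m} {2} {n} m<2n | m≡[m/n]*n
  where
  m≡[m/n]*n : m ≡ (m / n) * n
  m≡[m/n]*n = trans (m≡m%n+[m/n]*n m n) (cong (_+ (m / n) * n) m%n≡0)
... | 0           | _               | m≡0 = inj₁ m≡0
... | 1           | _               | m≡n = inj₂ (trans m≡n (+-identityʳ n))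
... | suc (suc _) | s≤s (s≤s ())    | _

module ℤₙ (n : ℕ) .{{_ : NonZero n}} where

  infixl 6 _+ₙ_ _-ₙ_

  0ₙ 1ₙ : Fin n
  0ₙ = 0 mod n
  1ₙ = oneZ n

  _+ₙ_ _-ₙ_ : Fin n → Fin n → Fin n
  _+ₙ_ = addZ n
  _-ₙ_ = subZ n

  negₙ : Fin n → Fin n
  negₙ = negZ n

  toℕ-mod : ∀ m → toℕ (m mod n) ≡ m % n
  toℕ-mod m = toℕ-fromℕ< (m%n<n m n)

  toℕ-0ₙ : toℕ 0ₙ ≡ 0
  toℕ-0ₙ = trans (toℕ-mod 0) (m<n⇒m%n≡m (>-nonZero⁻¹ n))

  mod-toℕ : ∀ x → toℕ x mod n ≡ x
  mod-toℕ x = toℕ-injective (trans (toℕ-mod (toℕ x)) (m<n⇒m%n≡m (toℕ<n x)))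

  %≡⇒mod≡ : ∀ {a b} → a % n ≡ b % n → a mod n ≡ b mod n
  %≡⇒mod≡ {a} {b} eq = toℕ-injective (trans (toℕ-mod a) (trans eq (sym (toℕ-mod b))))

  [a%n+b]%n≡[a+b]%n : ∀ a b → (a % n + b) % n ≡ (a + b) % n
  [a%n+b]%n≡[a+b]%n a b = begin
    (a % n + b) % n           ≡⟨ %-distribˡ-+ (a % n) b n ⟩
    (a % n % n + b % n) % n   ≡⟨ cong (λ r → (r + b % n) % n) (m%n%n≡m%n a n) ⟩
    (a % n + b % n) % n       ≡⟨ %-distribˡ-+ a b n ⟨
    (a + b) % n               ∎

  [a+b%n]%n≡[a+b]%n : ∀ a b → (a + b % n) % n ≡ (a + b) % n
  [a+b%n]%n≡[a+b]%n a b = begin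
    (a + b % n) % n ≡⟨ cong (_% n) (+-comm a (b % n)) ⟩
    (b % n + a) % n ≡⟨ [a%n+b]%n≡[a+b]%n b a ⟩
    (b + a) % n     ≡⟨ cong (_% n) (+-comm b a) ⟩
    (a + b) % n     ∎

  +ₙ-assoc : ∀ x y z → (x +ₙ y) +ₙ z ≡ x +ₙ (y +ₙ z)
  +ₙ-assoc x y z = %≡⇒mod≡ (begin
    (toℕ (x +ₙ y) + toℕ z) % n        ≡⟨ cong (λ r → (r + toℕ z) % n) (toℕ-mod _) ⟩
    ((toℕ x + toℕ y) % n + toℕ z) % n ≡⟨ [a%n+b]%n≡[a+b]%n (toℕ x + toℕ y) (toℕ z) ⟩
    (toℕ x + toℕ y + toℕ z) % n       ≡⟨ cong (_% n) (+-assoc (toℕ x) (toℕ y) (toℕ z)) ⟩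
    (toℕ x + (toℕ y + toℕ z)) % n     ≡⟨ [a+b%n]%n≡[a+b]%n (toℕ x) (toℕ y + toℕ z) ⟨
    (toℕ x + (toℕ y + toℕ z) % n) % n ≡⟨ cong (λ r → (toℕ x + r) % n) (toℕ-mod _) ⟨
    (toℕ x + toℕ (y +ₙ z)) % n        ∎)

  +ₙ-comm : ∀ x y → x +ₙ y ≡ y +ₙ x
  +ₙ-comm x y = cong (_mod n) (+-comm (toℕ x) (toℕ y))

  +ₙ-identityʳ : ∀ x → x +ₙ 0ₙ ≡ x
  +ₙ-identityʳ x = trans (cong (λ r → (toℕ x + r) mod n) toℕ-0ₙ)
                         (trans (cong (_mod n) (+-identityʳ (toℕ x))) (mod-toℕ x))

  +ₙ-inverseʳ : ∀ x → x +ₙ (negₙ x) ≡ 0ₙ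
  +ₙ-inverseʳ x = %≡⇒mod≡ (begin
    (toℕ x + toℕ (negₙ x)) % n      ≡⟨ cong (λ r → (toℕ x + r) % n) (toℕ-mod _) ⟩
    (toℕ x + (n ∸ toℕ x) % n) % n ≡⟨ [a+b%n]%n≡[a+b]%n (toℕ x) (n ∸ toℕ x) ⟩
    (toℕ x + (n ∸ toℕ x)) % n     ≡⟨ cong (_% n) (m+[n∸m]≡n (<⇒≤ (toℕ<n x))) ⟩
    n % n                         ≡⟨ n%n≡0 n ⟩
    0                             ≡⟨ m<n⇒m%n≡m (>-nonZero⁻¹ n) ⟨
    0 % n                         ∎)

  +ₙ-abelianGroup : AbelianGroup 0ℓ 0ℓ
  +ₙ-abelianGroup = record
    { Carrier = Fin n
    ; _≈_ = _≡_
    ; _∙_ = _+ₙ_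
    ; ε = 0ₙ
    ; _⁻¹ = negₙ
    ; isAbelianGroup = record
      { isGroup = record
        { isMonoid = record
          { isSemigroup = record
            { isMagma = record { isEquivalence = isEquivalence ; ∙-cong = cong₂ _+ₙ_ }
            ; assoc = +ₙ-assoc }
          ; identity = (λ x → trans (+ₙ-comm 0ₙ x) (+ₙ-identityʳ x)) , +ₙ-identityʳ }
        ; inverse = (λ x → trans (+ₙ-comm (negₙ x) x) (+ₙ-inverseʳ x)) , +ₙ-inverseʳ
        ; ⁻¹-cong = cong negₙ }
      ; comm = +ₙ-comm } }

  open AbelianGroup +ₙ-abelianGroup public
    using (identityˡ; identityʳ; inverseˡ; inverseʳ; commutativeSemigroup)
  open AbelianGroupProperties +ₙ-abelianGroup public
    using (∙-cancelˡ; x≈z//y; ε⁻¹≈ε; ⁻¹-anti-homo-∙; ⁻¹-anti-homo-//; ⁻¹-∙-comm)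
  open CommutativeSemigroupProperties commutativeSemigroup public using (xy∙z≈xz∙y)

  x-[y+z]≡[x-y]-z : ∀ x y z → x -ₙ (y +ₙ z) ≡ (x -ₙ y) -ₙ z
  x-[y+z]≡[x-y]-z x y z = trans (cong (x +ₙ_) (sym (⁻¹-∙-comm y z))) (sym (+ₙ-assoc x (negₙ y) (negₙ z)))

  [x-y]+[y+z]≡x+z : ∀ x y z → (x -ₙ y) +ₙ (y +ₙ z) ≡ x +ₙ z
  [x-y]+[y+z]≡x+z x y z = begin
    (x -ₙ y) +ₙ (y +ₙ z)       ≡⟨ +ₙ-assoc x (negₙ y) (y +ₙ z) ⟩
    x +ₙ (negₙ y +ₙ (y +ₙ z))  ≡⟨ cong (x +ₙ_) (+ₙ-assoc (negₙ y) y z) ⟨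
    x +ₙ ((negₙ y +ₙ y) +ₙ z)  ≡⟨ cong (λ r → x +ₙ (r +ₙ z)) (inverseˡ y) ⟩
    x +ₙ (0ₙ +ₙ z)             ≡⟨ cong (x +ₙ_) (identityˡ z) ⟩
    x +ₙ z                     ∎

  x+y≡z⇒y≡z-x : ∀ {x y z} → x +ₙ y ≡ z → y ≡ z -ₙ x
  x+y≡z⇒y≡z-x {x} {y} {z} eq = x≈z//y y x z (trans (+ₙ-comm y x) eq)

  x+[y-x]≡y : ∀ x y → x +ₙ (y -ₙ x) ≡ y
  x+[y-x]≡y x y = trans (+ₙ-comm x (y -ₙ x)) (trans (+ₙ-assoc y (negₙ x) x)
                (trans (cong (y +ₙ_) (inverseˡ x)) (identityʳ y)))

  mod-suc : ∀ m → (m mod n) +ₙ 1ₙ ≡ suc m mod n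
  mod-suc m = %≡⇒mod≡ (begin
    (toℕ (m mod n) + toℕ 1ₙ) % n ≡⟨ cong₂ (λ a b → (a + b) % n) (toℕ-mod m) (toℕ-mod 1) ⟩
    (m % n + 1 % n) % n          ≡⟨ [a%n+b]%n≡[a+b]%n m (1 % n) ⟩
    (m + 1 % n) % n              ≡⟨ [a+b%n]%n≡[a+b]%n m 1 ⟩
    (m + 1) % n                  ≡⟨ cong (_% n) (+-comm m 1) ⟩
    suc m % n                    ∎)

  x+x≡0⇒x≡0⊎x*2≡n : ∀ x → x +ₙ x ≡ 0ₙ → toℕ x ≡ 0 ⊎ toℕ x * 2 ≡ n
  x+x≡0⇒x≡0⊎x*2≡n x eq with m<2n∧m%n≡0⇒m≡0⊎m≡n x+x<2n x+x%n≡0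
    where
    x+x<2n : toℕ x + toℕ x < 2 * n
    x+x<2n = subst (toℕ x + toℕ x <_) (cong (n +_) (sym (+-identityʳ n))) (+-mono-< (toℕ<n x) (toℕ<n x))
    x+x%n≡0 : (toℕ x + toℕ x) % n ≡ 0
    x+x%n≡0 = trans (sym (toℕ-mod _)) (trans (cong toℕ eq) toℕ-0ₙ)
  ... | inj₁ x+x≡0 = inj₁ (m+n≡0⇒m≡0 (toℕ x) x+x≡0)
  ... | inj₂ x+x≡n = inj₂ (trans (m*2≡m+m (toℕ x)) x+x≡n)

  x*2≡n⇒x+x≡0 : ∀ x → toℕ x * 2 ≡ n → x +ₙ x ≡ 0ₙ
  x*2≡n⇒x+x≡0 x 2x≡n = toℕ-injective (begin
    toℕ (x +ₙ x)          ≡⟨ toℕ-mod _ ⟩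
    (toℕ x + toℕ x) % n   ≡⟨ cong (_% n) (trans (sym (m*2≡m+m (toℕ x))) 2x≡n) ⟩
    n % n                 ≡⟨ n%n≡0 n ⟩
    0                     ≡⟨ toℕ-0ₙ ⟨
    toℕ 0ₙ                ∎)

module PX (n k : ℕ) .{{_ : NonZero n}} (k<n : k < n) where
  open ℤₙ n

  offset : Fin k → Fin n
  offset t = toℕ t mod n

  toℕ-offset : ∀ t → toℕ (offset t) ≡ toℕ t
  toℕ-offset t = trans (toℕ-mod (toℕ t)) (m<n⇒m%n≡m (<-trans (toℕ<n t) k<n))

  offset-injective : ∀ {t u} → offset t ≡ offset u → t ≡ u
  offset-injective {t} {u} eq =
    toℕ-injective (trans (sym (toℕ-offset t)) (trans (cong toℕ eq) (toℕ-offset u)))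

  offset-fromℕ< : ∀ {g : Fin n} (g<k : toℕ g < k) → offset (fromℕ< g<k) ≡ g
  offset-fromℕ< g<k = toℕ-injective (trans (toℕ-offset _) (toℕ-fromℕ< g<k))

  window-injective : ∀ i {t u} → i +ₙ offset t ≡ i +ₙ offset u → t ≡ u
  window-injective i eq = offset-injective (∙-cancelˡ i _ _ eq)

  lastOffset : Fin n
  lastOffset = (k ∸ 1) mod n

  offset-opposite : ∀ t → offset (opposite t) +ₙ offset t ≡ lastOffset
  offset-opposite t = %≡⇒mod≡ (begin
    (toℕ (offset (opposite t)) + toℕ (offset t)) % n ≡⟨ cong₂ (λ a b → (a + b) % n) (toℕ-offset _) (toℕ-offset t) ⟩
    (toℕ (opposite t) + toℕ t) % n                   ≡⟨ cong (λ a → (a + toℕ t) % n) (opposite-prop t) ⟩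
    (k ∸ suc (toℕ t) + toℕ t) % n                    ≡⟨ cong (λ a → (a + toℕ t) % n) (∸-+-assoc k 1 (toℕ t)) ⟨
    (k ∸ 1 ∸ toℕ t + toℕ t) % n                      ≡⟨ cong (_% n) (m∸n+n≡m (∸-monoˡ-≤ 1 (toℕ<n t))) ⟩
    (k ∸ 1) % n                                      ∎)

  Pattern : Set
  Pattern = Fin n → Bool

  addWindow : Pattern → Fin n → Vec Bool k → Vec Bool k
  addWindow c i x = tabulate λ t → c (i +ₙ offset t) xor lookup x t

  lookup-addWindow : ∀ c i x t → lookup (addWindow c i x) t ≡ c (i +ₙ offset t) xor lookup x t
  lookup-addWindow c i x t = lookup∘tabulate _ t

  lookup-addWindow-false : ∀ c i t → lookup (addWindow c i (replicate k false)) t ≡ c (i +ₙ offset t)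
  lookup-addWindow-false c i t = trans (lookup-addWindow c i (replicate k false) t)
    (trans (cong (c (i +ₙ offset t) xor_) (lookup-replicate t false)) (xor-identityʳ _))

  addWindow-cancels : ∀ c i x t → c (i +ₙ offset t) ≡ lookup x t → lookup (addWindow c i x) t ≡ false
  addWindow-cancels c i x t c≡x =
    trans (lookup-addWindow c i x t) (trans (cong (_xor lookup x t) c≡x) (xor-same (lookup x t)))

  addWindow-cancels⁻¹ : ∀ c i x t → lookup (addWindow c i x) t ≡ false → c (i +ₙ offset t) ≡ lookup x t
  addWindow-cancels⁻¹ c i x t eq = xor≡false⇒≡ (trans (sym (lookup-addWindow c i x t)) eq)

  addWindow-xor : ∀ d c i x → addWindow d i (addWindow c i x) ≡ addWindow (λ g → d g xor c g) i x
  addWindow-xor d c i x = tabulate-cong λ t →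
    trans (cong (d (i +ₙ offset t) xor_) (lookup-addWindow c i x t)) (sym (xor-assoc (d _) (c _) (lookup x t)))

  addWindow-shift : ∀ c a i x → addWindow c (i +ₙ a) x ≡ addWindow (λ g → c (g +ₙ a)) i x
  addWindow-shift c a i x = tabulate-cong λ t → cong (λ g → c g xor lookup x t) (xy∙z≈xz∙y i a (offset t))

  reflectPoint : Fin n → Fin n → Fin n
  reflectPoint a g = (a -ₙ g) +ₙ lastOffset

  reflectPoint-window : ∀ a i t → reflectPoint a (i +ₙ offset (opposite t)) ≡ (a -ₙ i) +ₙ offset t
  reflectPoint-window a i t = begin
    (a -ₙ (i +ₙ o′)) +ₙ lastOffset   ≡⟨ cong ((a -ₙ (i +ₙ o′)) +ₙ_) (offset-opposite t) ⟨
    (a -ₙ (i +ₙ o′)) +ₙ (o′ +ₙ o)    ≡⟨ cong (_+ₙ (o′ +ₙ o)) (x-[y+z]≡[x-y]-z a i o′) ⟩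
    ((a -ₙ i) -ₙ o′) +ₙ (o′ +ₙ o)    ≡⟨ [x-y]+[y+z]≡x+z (a -ₙ i) o′ o ⟩
    (a -ₙ i) +ₙ o                    ∎
    where
    o = offset t
    o′ = offset (opposite t)

  addWindow-reflect : ∀ c a i x →
    addWindow c (a -ₙ i) (reverse x) ≡ reverse (addWindow (λ g → c (reflectPoint a g)) i x)
  addWindow-reflect c a i x = lookup-ext λ t → begin
    lookup (addWindow c (a -ₙ i) (reverse x)) t           ≡⟨ lookup-addWindow c (a -ₙ i) (reverse x) t ⟩
    c ((a -ₙ i) +ₙ offset t) xor lookup (reverse x) t     ≡⟨ cong₂ _xor_ (cong c (sym (reflectPoint-window a i t)))
                                                                          (lookup-reverse x t) ⟩
    c′ (i +ₙ offset (opposite t)) xor lookup x (opposite t) ≡⟨ lookup-addWindow c′ i x (opposite t) ⟨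
    lookup (addWindow c′ i x) (opposite t)                ≡⟨ lookup-reverse (addWindow c′ i x) t ⟨
    lookup (reverse (addWindow c′ i x)) t                 ∎
    where
    c′ : Pattern
    c′ g = c (reflectPoint a g)

  pointAt : Fin n → Pattern
  pointAt s g = does (g ≟ s)

  τ-addWindow : ∀ s i x → τ n k s (i , x) ≡ (i , addWindow (pointAt s) i x)
  τ-addWindow s i x with toℕ (s -ₙ i) <? k
  ... | yes s-i<k = cong (i ,_) (lookup-ext flipped)
    where
    u = fromℕ< s-i<k
    i+u≡s : i +ₙ offset u ≡ s
    i+u≡s = trans (cong (i +ₙ_) (offset-fromℕ< s-i<k)) (x+[y-x]≡y i s)
    flipped : ∀ t → lookup (updateAt x u not) t ≡ lookup (addWindow (pointAt s) i x) t
    flipped t with t ≟ u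
    ... | yes refl = begin
      lookup (updateAt x u not) u              ≡⟨ lookup∘updateAt u x ⟩
      not (lookup x u)                         ≡⟨ cong (_xor lookup x u) (dec-true (i +ₙ offset u ≟ s) i+u≡s) ⟨
      pointAt s (i +ₙ offset u) xor lookup x u ≡⟨ lookup-addWindow (pointAt s) i x u ⟨
      lookup (addWindow (pointAt s) i x) u     ∎
    ... | no t≢u = begin
      lookup (updateAt x u not) t              ≡⟨ lookup∘updateAt′ t u t≢u x ⟩
      lookup x t                               ≡⟨ cong (_xor lookup x t) (dec-false (i +ₙ offset t ≟ s) i+t≢s) ⟨
      pointAt s (i +ₙ offset t) xor lookup x t ≡⟨ lookup-addWindow (pointAt s) i x t ⟨
      lookup (addWindow (pointAt s) i x) t     ∎
      where
      i+t≢s : i +ₙ offset t ≢ s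
      i+t≢s i+t≡s = t≢u (window-injective i (trans i+t≡s (sym i+u≡s)))
  ... | no s-i≮k = cong (i ,_) (lookup-ext λ t → sym (trans (lookup-addWindow (pointAt s) i x t)
          (cong (_xor lookup x t) (dec-false (i +ₙ offset t ≟ s) (i+t≢s t)))))
    where
    i+t≢s : ∀ t → i +ₙ offset t ≢ s
    i+t≢s t i+t≡s = s-i≮k (subst (_< k) (trans (sym (toℕ-offset t)) (cong toℕ (x+y≡z⇒y≡z-x i+t≡s))) (toℕ<n t))

  NormalForm : Set
  NormalForm = Fin n × Bool × Pattern

  ⟦_⟧ : NormalForm → Vertex n k → Vertex n k
  ⟦ a , false , c ⟧ (i , x) = i +ₙ a , addWindow c i x
  ⟦ a , true  , c ⟧ (i , x) = a -ₙ i , reverse (addWindow c i x)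

  -- ⟦ p ⟧ carries the bit sitting at point g to point pointImage p g.
  pointImage : NormalForm → Fin n → Fin n
  pointImage (a , false , _) g = g +ₙ a
  pointImage (a , true  , _) g = reflectPoint a g

  step : Gen n k → NormalForm → NormalForm
  step gρ     (a , r , c) = a +ₙ 1ₙ , r , c
  step gρ⁻¹   (a , r , c) = a -ₙ 1ₙ , r , c
  step gμ     (a , r , c) = negₙ a , not r , c
  step (gτ s) (a , r , c) = a , r , λ g → pointAt s (pointImage (a , r , c) g) xor c g

  step-sound : ∀ g p v → actGen n k g (⟦ p ⟧ v) ≡ ⟦ step g p ⟧ v
  step-sound gρ   (a , false , c) (i , x) = cong (_, addWindow c i x) (+ₙ-assoc i a 1ₙ)
  step-sound gρ   (a , true  , c) (i , x) = cong (_, reverse (addWindow c i x)) (xy∙z≈xz∙y a (negₙ i) 1ₙ)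
  step-sound gρ⁻¹ (a , false , c) (i , x) = cong (_, addWindow c i x) (+ₙ-assoc i a (negₙ 1ₙ))
  step-sound gρ⁻¹ (a , true  , c) (i , x) = cong (_, reverse (addWindow c i x)) (xy∙z≈xz∙y a (negₙ i) (negₙ 1ₙ))
  step-sound gμ   (a , false , c) (i , x) = cong (_, reverse (addWindow c i x)) (⁻¹-anti-homo-∙ i a)
  step-sound gμ   (a , true  , c) (i , x) = cong₂ _,_ (⁻¹-anti-homo-// a i) (reverse-involutive _)
  step-sound (gτ s) (a , false , c) (i , x) = begin
    τ n k s (i +ₙ a , w)                                ≡⟨ τ-addWindow s (i +ₙ a) w ⟩
    i +ₙ a , addWindow (pointAt s) (i +ₙ a) w           ≡⟨ cong (i +ₙ a ,_) (addWindow-shift (pointAt s) a i w) ⟩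
    i +ₙ a , addWindow d i w                            ≡⟨ cong (i +ₙ a ,_) (addWindow-xor d c i x) ⟩
    ⟦ step (gτ s) (a , false , c) ⟧ (i , x)             ∎
    where
    w = addWindow c i x
    d : Pattern
    d g = pointAt s (g +ₙ a)
  step-sound (gτ s) (a , true , c) (i , x) = begin
    τ n k s (a -ₙ i , reverse w)                          ≡⟨ τ-addWindow s (a -ₙ i) (reverse w) ⟩
    a -ₙ i , addWindow (pointAt s) (a -ₙ i) (reverse w)   ≡⟨ cong (a -ₙ i ,_) (addWindow-reflect (pointAt s) a i w) ⟩
    a -ₙ i , reverse (addWindow d i w)                    ≡⟨ cong (λ w → a -ₙ i , reverse w) (addWindow-xor d c i x) ⟩
    ⟦ step (gτ s) (a , true , c) ⟧ (i , x)                ∎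
    where
    w = addWindow c i x
    d : Pattern
    d g = pointAt s (reflectPoint a g)

  ⟦id⟧ : ∀ v → ⟦ 0ₙ , false , (λ _ → false) ⟧ v ≡ v
  ⟦id⟧ (i , x) = cong₂ _,_ (identityʳ i) (tabulate∘lookup x)

  ⟦⟧-cong : ∀ a r {c c′} → (∀ g → c g ≡ c′ g) → ∀ v → ⟦ a , r , c ⟧ v ≡ ⟦ a , r , c′ ⟧ v
  ⟦⟧-cong a false c≗c′ (i , x) = cong (i +ₙ a ,_) (tabulate-cong λ t → cong (_xor lookup x t) (c≗c′ _))
  ⟦⟧-cong a true  c≗c′ (i , x) =
    cong (λ w → a -ₙ i , reverse w) (tabulate-cong λ t → cong (_xor lookup x t) (c≗c′ _))

  word-normalForm : ∀ w → ∃ λ p → ∀ v → actWord n k w v ≡ ⟦ p ⟧ v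
  word-normalForm []      = (0ₙ , false , λ _ → false) , λ v → sym (⟦id⟧ v)
  word-normalForm (g ∷ w) with word-normalForm w
  ... | p , w≗p = step g p , λ v → trans (cong (actGen n k g) (w≗p v)) (step-sound g p v)

  record Realisable (p : NormalForm) : Set where
    constructor realisedBy
    field
      word     : List (Gen n k)
      realises : ∀ v → actWord n k word v ≡ ⟦ p ⟧ v

  realisable-step : ∀ g {p} → Realisable p → Realisable (step g p)
  realisable-step g {p} (realisedBy w w≗p) =
    realisedBy (g ∷ w) λ v → trans (cong (actGen n k g) (w≗p v)) (step-sound g p v)

  realisable-cong : ∀ {a r c c′} → Realisable (a , r , c) → (∀ g → c g ≡ c′ g) → Realisable (a , r , c′)
  realisable-cong {a} {r} (realisedBy w w≗p) c≗c′ = realisedBy w λ v → trans (w≗p v) (⟦⟧-cong a r c≗c′ v)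

  realisable-toggle : ∀ s b {c} → Realisable (0ₙ , false , c) →
                      Realisable (0ₙ , false , λ g → (b ∧ pointAt s g) xor c g)
  realisable-toggle s false r = r
  realisable-toggle s true {c} r =
    realisable-cong (realisable-step (gτ s) r) λ g → cong (λ h → pointAt s h xor c g) (identityʳ g)

  realisable-pattern : ∀ m → m ≤ n → ∀ c → (∀ g → m ≤ toℕ g → c g ≡ false) → Realisable (0ₙ , false , c)
  realisable-pattern zero    _   c c≡false =
    realisable-cong (realisedBy [] λ v → sym (⟦id⟧ v)) λ g → sym (c≡false g z≤n)
  realisable-pattern (suc m) m<n c c≡false =
    realisable-cong (realisable-toggle s (c s) (realisable-pattern m (<⇒≤ m<n) c′ c′≡false)) untoggle
    where
    s = fromℕ< m<n
    toggle : Pattern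
    toggle g = c s ∧ pointAt s g
    c′ : Pattern
    c′ g = toggle g xor c g
    c′≡false : ∀ g → m ≤ toℕ g → c′ g ≡ false
    c′≡false g m≤g with g ≟ s
    ... | yes refl = trans (cong (_xor c s) (∧-identityʳ (c s))) (xor-same (c s))
    ... | no g≢s   = trans (cong (_xor c g) (∧-zeroʳ (c s))) (c≡false g (≤∧≢⇒< m≤g m≢g))
      where
      m≢g : m ≢ toℕ g
      m≢g m≡g = g≢s (toℕ-injective (trans (sym m≡g) (sym (toℕ-fromℕ< m<n))))
    untoggle : ∀ g → toggle g xor c′ g ≡ c g
    untoggle g = trans (sym (xor-assoc (toggle g) (toggle g) (c g))) (cong (_xor c g) (xor-same (toggle g)))

  realisable : ∀ p → Realisable p
  realisable (a , r , c) = subst (λ b → Realisable (b , r , c)) (mod-toℕ a) (shifted (toℕ a))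
    where
    preserving : Realisable (0ₙ , false , c)
    preserving = realisable-pattern n ≤-refl c λ g n≤g → ⊥-elim (<⇒≱ (toℕ<n g) n≤g)
    oriented : ∀ r → Realisable (0ₙ , r , c)
    oriented false = preserving
    oriented true  = subst (λ b → Realisable (b , true , c)) ε⁻¹≈ε (realisable-step gμ preserving)
    shifted : ∀ m → Realisable (m mod n , r , c)
    shifted zero    = oriented r
    shifted (suc m) = subst (λ b → Realisable (b , r , c)) (mod-suc m) (realisable-step gρ (shifted m))

  inA⇔normalForm : ∀ {α} → InA n k α ⇔ (∃ λ p → ∀ v → ⟦ p ⟧ v ≡ α v)
  inA⇔normalForm = mk⇔
    (λ (w , w≗α) → let p , w≗p = word-normalForm w in p , λ v → trans (sym (w≗p v)) (w≗α v))
    (λ (p , p≗α) → let realisedBy w w≗p = realisable p in w , λ v → trans (w≗p v) (p≗α v))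

  Agree : Fin n → Fin n → (Fin k → Bool) → (Fin k → Bool) → Set
  Agree i i′ f f′ = ∀ t u → i +ₙ offset t ≡ i′ +ₙ offset u → f t ≡ f′ u

  agree-refl : ∀ i f → Agree i i f f
  agree-refl i f t u i+t≡i+u = cong f (window-injective i i+t≡i+u)

  inWindow? : ∀ i g → Dec (∃ λ t → i +ₙ offset t ≡ g)
  inWindow? i g = any? λ t → i +ₙ offset t ≟ g

  glue : Fin n → Fin n → (Fin k → Bool) → (Fin k → Bool) → Pattern
  glue i i′ f f′ g with inWindow? i g | inWindow? i′ g
  ... | yes (t , _) | _           = f t
  ... | no _        | yes (u , _) = f′ u
  ... | no _        | no _        = false

  glue-first : ∀ i i′ f f′ t → glue i i′ f f′ (i +ₙ offset t) ≡ f t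
  glue-first i i′ f f′ t with inWindow? i (i +ₙ offset t)
  ... | yes (t′ , i+t′≡i+t) = cong f (window-injective i i+t′≡i+t)
  ... | no ∄t               = ⊥-elim (∄t (t , refl))

  glue-second : ∀ {i i′ f f′} → Agree i i′ f f′ → ∀ u → glue i i′ f f′ (i′ +ₙ offset u) ≡ f′ u
  glue-second {i} {i′} {f′ = f′} agree u with inWindow? i (i′ +ₙ offset u) | inWindow? i′ (i′ +ₙ offset u)
  ... | yes (t , i+t≡i′+u) | _                     = agree t u i+t≡i′+u
  ... | no _               | yes (u′ , i′+u′≡i′+u) = cong f′ (window-injective i′ i′+u′≡i′+u)
  ... | no _               | no ∄u                 = ⊥-elim (∄u (u , refl))

  origin : Vertex n k
  origin = 0ₙ , replicate k false

  module Swap (j : Fin n) (y : Vec Bool k) where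

    Swaps : (Vertex n k → Vertex n k) → Set
    Swaps α = α origin ≡ (j , y) × α (j , y) ≡ origin

    lookup-vertex : ∀ {v w : Vertex n k} → v ≡ w → ∀ t → lookup (proj₂ v) t ≡ lookup (proj₂ w) t
    lookup-vertex v≡w t = cong (λ v → lookup (proj₂ v) t) v≡w

    preserving-swap⇒ : ∀ {a c} → Swaps ⟦ a , false , c ⟧ → j +ₙ j ≡ 0ₙ × Agree j 0ₙ (lookup y) (lookup y)
    preserving-swap⇒ {a} {c} (o↦v , v↦o) =
      j+j≡0 , λ t u j+t≡u → trans (sym (c-at-j t)) (trans (cong c j+t≡u) (c-at-0 u))
      where
      j+j≡0 : j +ₙ j ≡ 0ₙ
      j+j≡0 = trans (cong (j +ₙ_) (trans (sym (cong proj₁ o↦v)) (identityˡ a))) (cong proj₁ v↦o)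
      c-at-0 : ∀ u → c (0ₙ +ₙ offset u) ≡ lookup y u
      c-at-0 u = trans (sym (lookup-addWindow-false c 0ₙ u)) (lookup-vertex o↦v u)
      c-at-j : ∀ t → c (j +ₙ offset t) ≡ lookup y t
      c-at-j t = addWindow-cancels⁻¹ c j y t (trans (lookup-vertex v↦o t) (lookup-replicate t false))

    preserving-swap⇐ : j +ₙ j ≡ 0ₙ → Agree j 0ₙ (lookup y) (lookup y) → ∃ λ c → Swaps ⟦ j , false , c ⟧
    preserving-swap⇐ j+j≡0 agree = c , o↦v , v↦o
      where
      c = glue j 0ₙ (lookup y) (lookup y)
      o↦v : ⟦ j , false , c ⟧ origin ≡ (j , y)
      o↦v = cong₂ _,_ (identityˡ j) (lookup-ext λ u →
              trans (lookup-addWindow-false c 0ₙ u) (glue-second agree u))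
      v↦o : ⟦ j , false , c ⟧ (j , y) ≡ origin
      v↦o = cong₂ _,_ j+j≡0 (lookup-ext λ t →
              trans (addWindow-cancels c j y t (glue-first j 0ₙ _ _ t)) (sym (lookup-replicate t false)))

    reversing-swap⇒ : ∀ {a c} → Swaps ⟦ a , true , c ⟧ → Agree j 0ₙ (lookup y) (lookup (reverse y))
    reversing-swap⇒ {a} {c} (o↦v , v↦o) t u j+t≡u =
      trans (sym (c-at-j t)) (trans (cong c j+t≡u) (c-at-0 u))
      where
      c-at-0 : ∀ u → c (0ₙ +ₙ offset u) ≡ lookup (reverse y) u
      c-at-0 u = trans (sym (lookup-addWindow-false c 0ₙ u)) (cong (λ w → lookup w u)
                   (sym (reverse-reverse {xs = addWindow c 0ₙ (replicate k false)} (cong proj₂ o↦v))))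
      c-at-j : ∀ t → c (j +ₙ offset t) ≡ lookup y t
      c-at-j t = addWindow-cancels⁻¹ c j y t (begin
        lookup (addWindow c j y) t                      ≡⟨ lookup-reverse-opposite (addWindow c j y) t ⟨
        lookup (reverse (addWindow c j y)) (opposite t) ≡⟨ lookup-vertex v↦o (opposite t) ⟩
        lookup (replicate k false) (opposite t)         ≡⟨ lookup-replicate (opposite t) false ⟩
        false                                           ∎)

    reversing-swap⇐ : Agree j 0ₙ (lookup y) (lookup (reverse y)) → ∃ λ c → Swaps ⟦ j , true , c ⟧
    reversing-swap⇐ agree = c , o↦v , v↦o
      where
      c = glue j 0ₙ (lookup y) (lookup (reverse y))
      o↦v : ⟦ j , true , c ⟧ origin ≡ (j , y)
      o↦v = cong₂ _,_ (trans (cong (j +ₙ_) ε⁻¹≈ε) (identityʳ j))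
              (reverse-reverse {xs = y} {ys = addWindow c 0ₙ (replicate k false)} (lookup-ext λ u →
                sym (trans (lookup-addWindow-false c 0ₙ u) (glue-second agree u))))
      v↦o : ⟦ j , true , c ⟧ (j , y) ≡ origin
      v↦o = cong₂ _,_ (inverseʳ j) (lookup-ext λ t → begin
              lookup (reverse (addWindow c j y)) t        ≡⟨ lookup-reverse (addWindow c j y) t ⟩
              lookup (addWindow c j y) (opposite t)       ≡⟨ addWindow-cancels c j y _ (glue-first j 0ₙ _ _ (opposite t)) ⟩
              false                                       ≡⟨ lookup-replicate t false ⟨
              lookup (replicate k false) t                ∎)

    -- m ranges over M = {0 , … , k − 1} ∩ {j , … , j + k − 1}.
    Overlap : (Fin k → Bool) → (Fin k → Bool) → Set
    Overlap f f′ = (m : Fin n) (p : toℕ m < k) (q : toℕ (m -ₙ j) < k) → f (fromℕ< q) ≡ f′ (fromℕ< p)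

    overlap⇔agree : ∀ f f′ → Overlap f f′ ⇔ Agree j 0ₙ f f′
    overlap⇔agree f f′ = mk⇔ overlap⇒agree agree⇒overlap
      where
      overlap⇒agree : Overlap f f′ → Agree j 0ₙ f f′
      overlap⇒agree on-overlap t u j+t≡0+u = subst₂ (λ t′ u′ → f t′ ≡ f′ u′) q↦t p↦u (on-overlap m p q)
        where
        m = 0ₙ +ₙ offset u
        m≡u : m ≡ offset u
        m≡u = identityˡ (offset u)
        t≡m-j : offset t ≡ m -ₙ j
        t≡m-j = x+y≡z⇒y≡z-x j+t≡0+u
        p : toℕ m < k
        p = subst (_< k) (sym (trans (cong toℕ m≡u) (toℕ-offset u))) (toℕ<n u)
        q : toℕ (m -ₙ j) < k
        q = subst (_< k) (trans (sym (toℕ-offset t)) (cong toℕ t≡m-j)) (toℕ<n t)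
        q↦t : fromℕ< q ≡ t
        q↦t = offset-injective (trans (offset-fromℕ< q) (sym t≡m-j))
        p↦u : fromℕ< p ≡ u
        p↦u = offset-injective (trans (offset-fromℕ< p) m≡u)
      agree⇒overlap : Agree j 0ₙ f f′ → Overlap f f′
      agree⇒overlap agree m p q = agree (fromℕ< q) (fromℕ< p) (begin
        j +ₙ offset (fromℕ< q)   ≡⟨ cong (j +ₙ_) (offset-fromℕ< q) ⟩
        j +ₙ (m -ₙ j)            ≡⟨ x+[y-x]≡y j m ⟩
        m                        ≡⟨ identityˡ m ⟨
        0ₙ +ₙ m                  ≡⟨ cong (0ₙ +ₙ_) (offset-fromℕ< p) ⟨
        0ₙ +ₙ offset (fromℕ< p)  ∎)

    Conditions : Set
    Conditions = toℕ j ≡ 0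
               ⊎ (toℕ j ≢ 0 × Overlap (lookup y) (lookup (reverse y)))
               ⊎ (toℕ j * 2 ≡ n × Overlap (lookup y) (lookup y))

    swaps⇒conditions : ∀ p → Swaps ⟦ p ⟧ → Conditions
    swaps⇒conditions (a , false , c) swaps with preserving-swap⇒ {a} {c} swaps
    ... | j+j≡0 , agree with x+x≡0⇒x≡0⊎x*2≡n j j+j≡0
    ...   | inj₁ j≡0  = inj₁ j≡0
    ...   | inj₂ 2j≡n = inj₂ (inj₂ (2j≡n , Equivalence.from (overlap⇔agree _ _) agree))
    swaps⇒conditions (a , true , c) swaps with toℕ j ℕ.≟ 0
    ... | yes j≡0 = inj₁ j≡0
    ... | no  j≢0 = inj₂ (inj₁ (j≢0 , Equivalence.from (overlap⇔agree _ _) (reversing-swap⇒ {a} {c} swaps)))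

    conditions⇒swaps : Conditions → ∃ λ p → Swaps ⟦ p ⟧
    conditions⇒swaps (inj₁ j≡0) =
      let c , swaps = preserving-swap⇐ j+j≡0 agree in (j , false , c) , swaps
      where
      j≡0ₙ : j ≡ 0ₙ
      j≡0ₙ = toℕ-injective (trans j≡0 (sym toℕ-0ₙ))
      j+j≡0 : j +ₙ j ≡ 0ₙ
      j+j≡0 = trans (cong₂ _+ₙ_ j≡0ₙ j≡0ₙ) (identityʳ 0ₙ)
      agree : Agree j 0ₙ (lookup y) (lookup y)
      agree = subst (λ i → Agree i 0ₙ (lookup y) (lookup y)) (sym j≡0ₙ) (agree-refl 0ₙ (lookup y))
    conditions⇒swaps (inj₂ (inj₁ (_ , on-overlap))) =
      let c , swaps = reversing-swap⇐ (Equivalence.to (overlap⇔agree _ _) on-overlap) in (j , true , c) , swaps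
    conditions⇒swaps (inj₂ (inj₂ (2j≡n , on-overlap))) =
      let c , swaps = preserving-swap⇐ (x*2≡n⇒x+x≡0 j 2j≡n) (Equivalence.to (overlap⇔agree _ _) on-overlap)
      in (j , false , c) , swaps

    swappedBy𝒜⇔swappedByNormalForm : (∃ λ α → InA n k α × Swaps α) ⇔ (∃ λ p → Swaps ⟦ p ⟧)
    swappedBy𝒜⇔swappedByNormalForm = mk⇔
      (λ (α , α∈𝒜 , o↦v , v↦o) → let p , p≗α = Equivalence.to inA⇔normalForm α∈𝒜
                                  in p , trans (p≗α origin) o↦v , trans (p≗α (j , y)) v↦o)
      (λ (p , swaps) → ⟦ p ⟧ , Equivalence.from inA⇔normalForm (p , λ _ → refl) , swaps)

    swappedByNormalForm⇔conditions : (∃ λ p → Swaps ⟦ p ⟧) ⇔ Conditions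
    swappedByNormalForm⇔conditions = mk⇔ (λ (p , swaps) → swaps⇒conditions p swaps) conditions⇒swaps

corollary5p3 : (n k : ℕ) .{{_ : NonZero n}} → 3 ≤ n → 1 ≤ k → k < n →
    (j : Fin n) (y : Vec Bool k) →
    (∃ λ (α : Vertex n k → Vertex n k) → InA n k α
        × α (0 mod n , replicate k false) ≡ (j , y)
        × α (j , y) ≡ (0 mod n , replicate k false))
    ⇔
    (toℕ j ≡ 0
      ⊎ (toℕ j ≢ 0
          × ((m : Fin n) (p : toℕ m < k) (q : toℕ (subZ n m j) < k) →
               lookup y (fromℕ< q) ≡ lookup (reverse y) (fromℕ< p)))
      ⊎ (toℕ j * 2 ≡ n
          × ((m : Fin n) (p : toℕ m < k) (q : toℕ (subZ n m j) < k) →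
               lookup y (fromℕ< q) ≡ lookup y (fromℕ< p))))
corollary5p3 n k _ _ k<n j y = swappedByNormalForm⇔conditions ⇔-∘ swappedBy𝒜⇔swappedByNormalForm
  where open PX n k k<n; open Swap j y
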